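{- Let $(\Sigma, E, PRE)$ be any event model whose preconditions are formulas of $\mathcal{L}_{\exists, U}$. Then $\mathcal{L}_{\exists, U}$ is computably closed for product update: for every $\alpha \in \Sigma$ and every $\psi \in \mathcal{L}_{\exists, U}$ there is $\chi \in \mathcal{L}_{\exists, U}$ such that $\chi$ and $\langle \alpha \rangle \psi$ are true at exactly the same points of every model, i.e. $\vDash \chi \equiv \langle \alpha \rangle \psi$; moreover $\chi$ is effectively computable from $\psi$ and $(\Sigma, E, PRE, \alpha)$.
   Context: A (relational) model is $\mathcal{M} = (\Omega, R, V)$ with $\Omega$ a non-empty set, $R \subseteq \Omega \times \Omega$, and $V$ assigning to each proposition letter $p$ a set $V(p) \subseteq \Omega$. $\mathcal{M}[p \mapsto X]$ is the model that agrees with $\mathcal{M}$ except that $p$ is now valued as $X$. The language $\mathcal{L}_{\exists, U}$ is $\varphi ::= p \mid \neg\varphi \mid \varphi \land \varphi \mid \square \varphi \mid \exists p.\varphi \mid U\varphi$, with the usual Boolean clauses, $\mathcal{M},\omega \vDash p$ iff $\omega \in V(p)$, $\mathcal{M},\omega \vDash \square\varphi$ iff every $R$-successor of $\omega$ satisfies $\varphi$, $\mathcal{M},\omega \vDash \exists p.\varphi$ iff there is $X \subseteq \Omega$ with $\mathcal{M}[p\mapsto X],\omega \vDash \varphi$, and $\mathcal{M},\omega \vDash U\varphi$ iff every point of $\Omega$ satisfies $\varphi$. An event model is $\mathcal{A} = (\Sigma, E, PRE)$ with $\Sigma$ a finite non-empty set of events, $E \subseteq \Sigma \times \Sigma$,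 and $PRE$ assigning to each $\alpha \in \Sigma$ a formula $Pre_\alpha$. The product update $\mathcal{M} \otimes \mathcal{A}$ is the model with domain $\{(\omega,\alpha) \in \Omega \times \Sigma \mid \mathcal{M},\omega \vDash Pre_\alpha\}$, in which $(\omega,\alpha)$ is related to $(\omega',\alpha')$ iff $\omega R \omega'$ and $\alpha E \alpha'$, and with $V_{\otimes}(p) = \{(\omega,\alpha) \mid \omega \in V(p)\}$ (restricted to the domain). For $\alpha \in \Sigma$, the action modality has semantics $\mathcal{M},\omega \vDash \langle\alpha\rangle\varphi$ iff $\mathcal{M},\omega \vDash Pre_\alpha$ and $\mathcal{M}\otimes\mathcal{A}, (\omega,\alpha) \vDash \varphi$. -}

module Defs where

open import Data.Nat using (ℕ; _≡ᵇ_)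
open import Data.Bool using (Bool; if_then_else_; T)
open import Data.Fin using (Fin)
open import Data.Product using (Σ; _×_; _,_)
open import Data.Empty using (⊥)
open import Relation.Nullary using (¬_)
open import Data.Sum using (_⊎_)

data Form : Set where
  var  : ℕ → Form
  neg  : Form → Form
  conj : Form → Form → Form
  box  : Form → Form
  ex   : ℕ → Form → Form
  univ : Form → Form

-- Relational models. Sets of points (valuations and the subsets quantified
-- over by ∃p) are represented by characteristic functions Ω → Bool
-- (classical reading).
record Model : Set₁ where
  field
    Ω : Set
    R : Ω → Ω → Set
    V : ℕ → Ω → Bool
open Model public

_[_↦_] : (M : Model) → ℕ → (Ω M → Bool) → Model
M [ p ↦ X ] = record
  { Ω = Ω M
  ; R = R M
  ; V = λ q → if p ≡ᵇ q then X else V M q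
  }

_,_⊨_ : (M : Model) → Ω M → Form → Set
M , w ⊨ var p    = T (V M p w)
M , w ⊨ neg φ    = ¬ (M , w ⊨ φ)
M , w ⊨ conj φ ψ = (M , w ⊨ φ) × (M , w ⊨ ψ)
M , w ⊨ box φ    = ∀ v → R M w v → M , v ⊨ φ
M , w ⊨ ex p φ   = Σ (Ω M → Bool) (λ X → (M [ p ↦ X ]) , w ⊨ φ)
M , w ⊨ univ φ   = ∀ v → M , v ⊨ φ

record EventModel : Set where
  field
    k   : ℕ
    E   : Fin (ℕ.suc k) → Fin (ℕ.suc k) → Bool
    Pre : Fin (ℕ.suc k) → Form
open EventModel public

Ev : EventModel → Set
Ev A = Fin (ℕ.suc (k A))

-- The proof of the precondition is irrelevant, so the domain is exactly
-- the subset {(ω,α) | M,ω ⊨ Pre_α} of Ω × Σ (no duplicated points).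
record Point (M : Model) (A : EventModel) : Set where
  constructor ⟨_,_⟩[_]
  field
    world : Ω M
    event : Ev A
    .holds : M , world ⊨ Pre A event
open Point public

_⊗_ : Model → EventModel → Model
M ⊗ A = record
  { Ω = Point M A
  ; R = λ x y → R M (world x) (world y) × T (E A (event x) (event y))
  ; V = λ p x → V M p (world x)
  }

_,_⊨⟨_,_⟩_ : (M : Model) → Ω M → (A : EventModel) → Ev A → Form → Set
M , w ⊨⟨ A , a ⟩ ψ =
  Σ (M , w ⊨ Pre A a) (λ pre → (M ⊗ A) , ⟨ w , a ⟩[ pre ] ⊨ ψ)

LEM : Set₁
LEM = (P : Set) → P ⊎ ¬ P

-- A point (w, β) of M ⊗ A is simulated at the world w of M by reading each letter
-- p at event β as a letter σ p β of M. The Boolean connectives commute with this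
-- reading; □ and U become conjunctions over the events β′, guarded by E and by
-- Pre β′; and ∃p, which chooses a set of points of the product, becomes one
-- existential per event β′ choosing the fibre over β′, bound to a fresh letter.
-- Fresh letters are taken above those of the preconditions, which therefore keep
-- their meaning. Excluded middle is used to split a set of points into fibres and
-- to read the encoded implication Pre β′ ⇒ φ.
module Submission where

open import Defs
open import Data.Product using (Σ-syntax)
open import Function.Bundles using (_⇔_)

open import Data.Bool using (Bool; true; false; if_then_else_; T)
open import Data.Empty using (⊥-elim)
open import Data.Fin using (Fin; toℕ) renaming (zero to fzero; suc to fsuc)
open import Data.Fin.Properties using (toℕ<n)
open import Data.Nat using (ℕ; zero; suc; _≡ᵇ_; _<_; _≤_; _+_; _⊔_)
open import Data.Nat.Properties
open import Data.Product using (_,_)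
open import Data.Product.Function.NonDependent.Propositional using (_×-⇔_)
open import Data.Sum using (inj₁; inj₂)
open import Data.Unit using (tt)
open import Function.Base using (_∘_)
open import Function.Bundles using (mk⇔; module Equivalence)
open import Function.Related.TypeIsomorphisms using (¬-cong-⇔)
open import Relation.Binary.PropositionalEquality
open import Relation.Nullary.Decidable.Core using (recompute; fromSum)
open import Relation.Nullary.Recomputable using (Recomputable; ⊥-recompute)

open Equivalence using (to; from)

LEM⇒recomputable : LEM → {P : Set} → Recomputable P
LEM⇒recomputable lem {P} = recompute (fromSum (lem P))

infixl 25 _with-val_
infixr 25 _⇒_

_with-val_ : (M : Model) → (ℕ → Ω M → Bool) → Model
M with-val U = record { Ω = Ω M ; R = R M ; V = U }

update : {X Y : Set} → (ℕ → X → Y) → ℕ → (X → Y) → ℕ → X → Y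
update f p g q = if p ≡ᵇ q then g else f q

update-≢ : {X Y : Set} (f : ℕ → X → Y) {p : ℕ} (g : X → Y) {q : ℕ} →
           p ≢ q → update f p g q ≡ f q
update-≢ f {p} g {q} p≢q with p ≡ᵇ q in eq
... | true  = ⊥-elim (p≢q (≡ᵇ⇒≡ p q (subst T (sym eq) tt)))
... | false = refl

update-≡ : {X Y : Set} (f : ℕ → X → Y) (p : ℕ) (g : X → Y) → update f p g p ≡ g
update-≡ f p g with p ≡ᵇ p in eq
... | true  = refl
... | false = ⊥-elim (subst T eq (≡⇒≡ᵇ p p refl))

updateBlock : {X : Set} → ℕ → ∀ m → (Fin m → X → Bool) → (ℕ → X → Bool) → ℕ → X → Bool
updateBlock n zero    Y U = U
updateBlock n (suc m) Y U = updateBlock (suc n) m (Y ∘ fsuc) (update U n (Y fzero))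

updateBlock-< : {X : Set} (n m : ℕ) (Y : Fin m → X → Bool) (U : ℕ → X → Bool) {q : ℕ} →
                q < n → updateBlock n m Y U q ≡ U q
updateBlock-< n zero    Y U q<n = refl
updateBlock-< n (suc m) Y U q<n = begin
  updateBlock (suc n) m (Y ∘ fsuc) (update U n (Y fzero)) _ ≡⟨ updateBlock-< (suc n) m _ _ (m<n⇒m<1+n q<n) ⟩
  update U n (Y fzero) _                                    ≡⟨ update-≢ U _ (>⇒≢ q<n) ⟩
  U _                                                       ∎
  where open ≡-Reasoning

updateBlock-at : {X : Set} (n m : ℕ) (Y : Fin m → X → Bool) (U : ℕ → X → Bool) (i : Fin m) →
                 updateBlock n m Y U (n + toℕ i) ≡ Y i
updateBlock-at n (suc m) Y U fzero rewrite +-identityʳ n = begin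
  updateBlock (suc n) m (Y ∘ fsuc) (update U n (Y fzero)) n ≡⟨ updateBlock-< (suc n) m _ _ ≤-refl ⟩
  update U n (Y fzero) n                                    ≡⟨ update-≡ U n _ ⟩
  Y fzero                                                   ∎
  where open ≡-Reasoning
updateBlock-at n (suc m) Y U (fsuc i) rewrite +-suc n (toℕ i) =
  updateBlock-at (suc n) m (Y ∘ fsuc) (update U n (Y fzero)) i

letterBound : Form → ℕ
letterBound (var p)    = suc p
letterBound (neg φ)    = letterBound φ
letterBound (conj φ ψ) = letterBound φ ⊔ letterBound ψ
letterBound (box φ)    = letterBound φ
letterBound (ex p φ)   = letterBound φ
letterBound (univ φ)   = letterBound φ

coincidence : (M : Model) (φ : Form) (U U′ : ℕ → Ω M → Bool) →
              (∀ q → q < letterBound φ → U q ≡ U′ q) →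
              ∀ w → M with-val U , w ⊨ φ → M with-val U′ , w ⊨ φ
coincidence M (var p) U U′ agree w s = subst T (cong-app (agree p ≤-refl) w) s
coincidence M (neg φ) U U′ agree w s =
  s ∘ coincidence M φ U′ U (λ q q< → sym (agree q q<)) w
coincidence M (conj φ ψ) U U′ agree w (s , t) =
  coincidence M φ U U′ (λ q q< → agree q (<-≤-trans q< (m≤m⊔n _ _))) w s ,
  coincidence M ψ U U′ (λ q q< → agree q (<-≤-trans q< (m≤n⊔m _ _))) w t
coincidence M (box φ) U U′ agree w s = λ v r → coincidence M φ U U′ agree v (s v r)
coincidence M (ex p φ) U U′ agree w (X , s) =
  X , coincidence M φ (update U p X) (update U′ p X) agree′ w s
  where
  agree′ : ∀ q → q < letterBound φ → update U p X q ≡ update U′ p X q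
  agree′ q q< with p ≡ᵇ q
  ... | true  = refl
  ... | false = agree q q<
coincidence M (univ φ) U U′ agree w s = λ v → coincidence M φ U U′ agree v (s v)

⋀ : ∀ m → (Fin (suc m) → Form) → Form
⋀ zero    f = f fzero
⋀ (suc m) f = conj (f fzero) (⋀ m (f ∘ fsuc))

letterBound-⋀ : ∀ m (f : Fin (suc m) → Form) i → letterBound (f i) ≤ letterBound (⋀ m f)
letterBound-⋀ zero    f fzero    = ≤-refl
letterBound-⋀ (suc m) f fzero    = m≤m⊔n _ _
letterBound-⋀ (suc m) f (fsuc i) = ≤-trans (letterBound-⋀ m (f ∘ fsuc) i) (m≤n⊔m _ _)

⊤ᶠ : Form
⊤ᶠ = neg (conj (var 0) (neg (var 0)))

when : Bool → Form → Form
when b φ = if b then φ else ⊤ᶠ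

_⇒_ : Form → Form → Form
φ ⇒ ψ = neg (conj φ (neg ψ))

exBlock : ℕ → ℕ → Form → Form
exBlock n zero    φ = φ
exBlock n (suc m) φ = ex n (exBlock (suc n) m φ)

module _ (M : Model) (w : Ω M) where

  ⋀-intro : ∀ m f → (∀ i → M , w ⊨ f i) → M , w ⊨ ⋀ m f
  ⋀-intro zero    f h = h fzero
  ⋀-intro (suc m) f h = h fzero , ⋀-intro m (f ∘ fsuc) (h ∘ fsuc)

  ⋀-elim : ∀ m f → M , w ⊨ ⋀ m f → ∀ i → M , w ⊨ f i
  ⋀-elim zero    f s       fzero    = s
  ⋀-elim (suc m) f (s , t) fzero    = s
  ⋀-elim (suc m) f (s , t) (fsuc i) = ⋀-elim m (f ∘ fsuc) t i

  when-intro : ∀ b φ → (T b → M , w ⊨ φ) → M , w ⊨ when b φ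
  when-intro true  φ h = h tt
  when-intro false φ h = λ (s , ¬s) → ¬s s

  when-elim : ∀ b φ → T b → M , w ⊨ when b φ → M , w ⊨ φ
  when-elim true φ _ s = s

  ⇒-intro : ∀ φ ψ → (M , w ⊨ φ → M , w ⊨ ψ) → M , w ⊨ φ ⇒ ψ
  ⇒-intro φ ψ h (s , ¬t) = ¬t (h s)

  ⇒-elim : LEM → ∀ φ ψ → M , w ⊨ φ ⇒ ψ → M , w ⊨ φ → M , w ⊨ ψ
  ⇒-elim lem φ ψ s t with lem (M , w ⊨ ψ)
  ... | inj₁ u  = u
  ... | inj₂ ¬u = ⊥-elim (s (t , ¬u))

exBlock-intro : (M : Model) (n m : ℕ) (Y : Fin m → Ω M → Bool) (w : Ω M) (φ : Form) →
                M with-val updateBlock n m Y (V M) , w ⊨ φ → M , w ⊨ exBlock n m φ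
exBlock-intro M n zero    Y w φ s = s
exBlock-intro M n (suc m) Y w φ s =
  Y fzero , exBlock-intro (M [ n ↦ Y fzero ]) (suc n) m (Y ∘ fsuc) w φ s

exBlock-elim : (M : Model) (n m : ℕ) (w : Ω M) (φ : Form) → M , w ⊨ exBlock n m φ →
               Σ[ Y ∈ (Fin m → Ω M → Bool) ] M with-val updateBlock n m Y (V M) , w ⊨ φ
exBlock-elim M n zero    w φ s       = (λ ()) , s
exBlock-elim M n (suc m) w φ (X , s) with exBlock-elim (M [ n ↦ X ]) (suc n) m w φ s
... | Y , t = (λ { fzero → X ; (fsuc i) → Y i }) , t

module Reduction (A : EventModel) where

  overEvents : (Ev A → Bool) → (Ev A → Form) → Form
  overEvents g f = ⋀ (k A) (λ β → when (g β) (Pre A β ⇒ f β))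

  -- translate σ n β φ expresses φ at the point (w, β) of the product as a formula
  -- at w: the letter q at event β becomes σ q β, and a quantified letter becomes
  -- one fresh letter per event, taken from n onwards.
  translate : (ℕ → Ev A → ℕ) → ℕ → Ev A → Form → Form
  translate σ n β (var q)    = var (σ q β)
  translate σ n β (neg φ)    = neg (translate σ n β φ)
  translate σ n β (conj φ ψ) = conj (translate σ n β φ) (translate σ n β ψ)
  translate σ n β (box φ)    = box (overEvents (E A β) (λ β′ → translate σ n β′ φ))
  translate σ n β (ex p φ)   =
    exBlock n (suc (k A)) (translate (update σ p (λ β′ → n + toℕ β′)) (n + suc (k A)) β φ)
  translate σ n β (univ φ)   = univ (overEvents (λ _ → true) (λ β′ → translate σ n β′ φ))

  preBound : ℕ
  preBound = letterBound (⋀ (k A) (Pre A))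

  reduction : Ev A → Form → Form
  reduction a ψ = conj (Pre A a) (translate (λ q _ → q) (letterBound ψ ⊔ preBound) a ψ)

  module Correctness (lem : LEM) (M : Model) (B : ℕ) where

    record Tracks (σ : ℕ → Ev A → ℕ) (n : ℕ) (U : ℕ → Point M A → Bool)
                  (V′ : ℕ → Ω M → Bool) : Set where
      field
        letter-agrees : ∀ q → q < B → ∀ x → U q x ≡ V′ (σ q (event x)) (world x)
        letter-fresh  : ∀ q → q < B → ∀ β → σ q β < n
        pre-unchanged : ∀ q → q < preBound → V′ q ≡ V M q
        preBound≤     : preBound ≤ n
    open Tracks

    Tracks-bind : ∀ {σ n U V′} → Tracks σ n U V′ →
                  ∀ p (X : Point M A → Bool) (Y : Ev A → Ω M → Bool) →
                  (∀ x → X x ≡ Y (event x) (world x)) →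
                  Tracks (update σ p (λ β → n + toℕ β)) (n + suc (k A)) (update U p X)
                         (updateBlock n (suc (k A)) Y V′)
    Tracks-bind {σ} {n} {U} {V′} t p X Y X≡Y = record
      { letter-agrees = agrees
      ; letter-fresh  = fresh
      ; pre-unchanged = λ q q< →
          trans (updateBlock-< n _ Y V′ (<-≤-trans q< (preBound≤ t))) (pre-unchanged t q q<)
      ; preBound≤     = ≤-trans (preBound≤ t) (m≤m+n n _)
      }
      where
      σ′ : ℕ → Ev A → ℕ
      σ′ = update σ p (λ β → n + toℕ β)

      V″ : ℕ → Ω M → Bool
      V″ = updateBlock n (suc (k A)) Y V′

      agrees : ∀ q → q < B → ∀ x → update U p X q x ≡ V″ (σ′ q (event x)) (world x)
      agrees q q< x with p ≡ᵇ q
      ... | true  = trans (X≡Y x) (sym (cong-app (updateBlock-at n _ Y V′ (event x)) (world x)))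
      ... | false = trans (letter-agrees t q q< x)
                          (sym (cong-app (updateBlock-< n _ Y V′ (letter-fresh t q q< (event x))) (world x)))

      fresh : ∀ q → q < B → ∀ β → σ′ q β < n + suc (k A)
      fresh q q< β with p ≡ᵇ q
      ... | true  = +-monoʳ-< n (toℕ<n β)
      ... | false = <-≤-trans (letter-fresh t q q< β) (m≤m+n n _)

    fibre : (Point M A → Bool) → Ev A → Ω M → Bool
    fibre X β v with lem (M , v ⊨ Pre A β)
    ... | inj₁ h = X ⟨ v , β ⟩[ h ]
    ... | inj₂ _ = false

    fibre-point : ∀ X x → X x ≡ fibre X (event x) (world x)
    fibre-point X ⟨ v , β ⟩[ h ] with lem (M , v ⊨ Pre A β)
    ... | inj₁ _  = refl
    ... | inj₂ ¬h = ⊥-elim (⊥-recompute (¬h h))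

    pre-holds : (x : Point M A) → M , world x ⊨ Pre A (event x)
    pre-holds ⟨ _ , _ ⟩[ h ] = LEM⇒recomputable lem h

    pre-transfer : {V′ : ℕ → Ω M → Bool} → (∀ q → q < preBound → V′ q ≡ V M q) →
                   ∀ β v → (M with-val V′ , v ⊨ Pre A β) ⇔ (M , v ⊨ Pre A β)
    pre-transfer {V′} agree β v = mk⇔
      (coincidence M (Pre A β) V′ (V M) agree′ v)
      (coincidence M (Pre A β) (V M) V′ (λ q q< → sym (agree′ q q<)) v)
      where
      agree′ : ∀ q → q < letterBound (Pre A β) → V′ q ≡ V M q
      agree′ q q< = agree q (<-≤-trans q< (letterBound-⋀ (k A) (Pre A) β))

    Correct : Form → Set
    Correct φ = letterBound φ ≤ B → ∀ {σ n U V′} → Tracks σ n U V′ → ∀ x →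
                ((M ⊗ A) with-val U , x ⊨ φ) ⇔ (M with-val V′ , world x ⊨ translate σ n (event x) φ)

    ⊨-overEvents : ∀ φ {σ n U V′} → Correct φ → letterBound φ ≤ B → Tracks σ n U V′ → ∀ g v →
                   (M with-val V′ , v ⊨ overEvents g (λ β → translate σ n β φ)) ⇔
                   (∀ β (h : M , v ⊨ Pre A β) → T (g β) → (M ⊗ A) with-val U , ⟨ v , β ⟩[ h ] ⊨ φ)
    ⊨-overEvents φ {σ} {n} {U} {V′} c b t g v = mk⇔
      (λ s β h e → from (c b t ⟨ v , β ⟩[ h ])
         (⇒-elim M′ v lem (Pre A β) (translate σ n β φ)
           (when-elim M′ v (g β) _ e (⋀-elim M′ v (k A) _ s β))
           (from (pre-transfer (pre-unchanged t) β v) h)))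
      (λ h → ⋀-intro M′ v (k A) _ λ β →
         when-intro M′ v (g β) _ λ e →
           ⇒-intro M′ v (Pre A β) (translate σ n β φ) λ pre →
             to (c b t _) (h β (to (pre-transfer (pre-unchanged t) β v) pre) e))
      where
      M′ : Model
      M′ = M with-val V′

    correct-var : ∀ q → Correct (var q)
    correct-var q q< t x =
      mk⇔ (subst T (letter-agrees t q q< x)) (subst T (sym (letter-agrees t q q< x)))

    correct-neg : ∀ φ → Correct φ → Correct (neg φ)
    correct-neg φ c b t x = ¬-cong-⇔ (c b t x)

    correct-conj : ∀ φ ψ → Correct φ → Correct ψ → Correct (conj φ ψ)
    correct-conj φ ψ cφ cψ b t x =
      cφ (≤-trans (m≤m⊔n _ _) b) t x ×-⇔ cψ (≤-trans (m≤n⊔m _ _) b) t x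

    correct-box : ∀ φ → Correct φ → Correct (box φ)
    correct-box φ c b t x = mk⇔
      (λ s v r → from (⊨-overEvents φ c b t (E A (event x)) v) λ β h e → s ⟨ v , β ⟩[ h ] (r , e))
      (λ s y (r , e) →
         to (⊨-overEvents φ c b t (E A (event x)) (world y)) (s (world y) r) (event y) (pre-holds y) e)

    correct-univ : ∀ φ → Correct φ → Correct (univ φ)
    correct-univ φ c b t x = mk⇔
      (λ s v → from (⊨-overEvents φ c b t (λ _ → true) v) λ β h _ → s ⟨ v , β ⟩[ h ])
      (λ s y →
         to (⊨-overEvents φ c b t (λ _ → true) (world y)) (s (world y)) (event y) (pre-holds y) tt)

    correct-ex : ∀ p φ → Correct φ → Correct (ex p φ)
    correct-ex p φ c b {σ} {n} {U} {V′} t x = mk⇔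
      (λ (X , s) → exBlock-intro (M with-val V′) n (suc (k A)) (fibre X) (world x) _
                     (to (c b (Tracks-bind t p X (fibre X) (fibre-point X)) x) s))
      (λ s → let (Y , s′) = exBlock-elim (M with-val V′) n (suc (k A)) (world x) _ s in
             (λ y → Y (event y) (world y)) , from (c b (Tracks-bind t p _ Y (λ _ → refl)) x) s′)

    correct : ∀ φ → Correct φ
    correct (var q)    = correct-var q
    correct (neg φ)    = correct-neg φ (correct φ)
    correct (conj φ ψ) = correct-conj φ ψ (correct φ) (correct ψ)
    correct (box φ)    = correct-box φ (correct φ)
    correct (ex p φ)   = correct-ex p φ (correct φ)
    correct (univ φ)   = correct-univ φ (correct φ)

  reduction-correct : LEM → ∀ a ψ (M : Model) (w : Ω M) →
                      (M , w ⊨ reduction a ψ) ⇔ (M , w ⊨⟨ A , a ⟩ ψ)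
  reduction-correct lem a ψ M w = mk⇔
    (λ (pre , s) → pre , from (translation pre) s)
    (λ (pre , s) → pre , to (translation pre) s)
    where
    open Correctness lem M (letterBound ψ)

    initial : Tracks (λ q _ → q) (letterBound ψ ⊔ preBound) (V (M ⊗ A)) (V M)
    initial = record
      { letter-agrees = λ _ _ _ → refl
      ; letter-fresh  = λ _ q< _ → <-≤-trans q< (m≤m⊔n _ _)
      ; pre-unchanged = λ _ _ → refl
      ; preBound≤     = m≤n⊔m _ _
      }

    translation : (pre : M , w ⊨ Pre A a) →
                  ((M ⊗ A) , ⟨ w , a ⟩[ pre ] ⊨ ψ) ⇔
                  (M , w ⊨ translate (λ q _ → q) (letterBound ψ ⊔ preBound) a ψ)
    translation pre = correct ψ ≤-refl initial ⟨ w , a ⟩[ pre ]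

theorem1 : Σ[ tr ∈ ((A : EventModel) → Ev A → Form → Form) ]
             (LEM → (A : EventModel) (a : Ev A) (ψ : Form) (M : Model) (w : Ω M) →
               ((M , w ⊨ tr A a ψ) ⇔ (M , w ⊨⟨ A , a ⟩ ψ)))
theorem1 = Reduction.reduction , λ lem A → Reduction.reduction-correct A lem
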